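{- Let $p$ be a prime, $m\ge1$, $\sigma:\mathcal A_m\to\mathcal A_m^*$ a $p$-uniform morphism and $a\in\mathbb{F}_p$. Then for every $n\in\mathbb N$, $M_{\sigma^n}(a)=M_\sigma(a)^n$.
   Context: $\mathcal A_m=\{0,\dots,m-1\}$. For a word $W=w_0\cdots w_{r-1}$ over $\mathcal A_m$ and $j\in\mathcal A_m$, $\beta_{W,j}(T)=\sum_{l:\,w_{r-1-l}=j}T^l\in\mathbb{F}_p[T]$ ($0$ if $j$ does not occur). For a uniform morphism $\tau$ on $\mathcal A_m$, $M_\tau(T)$ is the $m\times m$ matrix over $\mathbb{F}_p[T]$ with $(i,j)$ entry $\beta_{\tau(i),j}(T)$; $M_\tau(a)$ is its evaluation at $T=a$. -}

module Defs where

open import Data.Nat using (ℕ; zero; suc; NonZero)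
import Data.Nat as ℕ
open import Data.Nat.DivMod using (_mod_)
open import Data.Fin using (Fin; toℕ; _≟_)
open import Data.List using (List; []; _∷_; reverse; concatMap; [_])
open import Relation.Nullary using (yes; no)

module Fp (p : ℕ) .{{_ : NonZero p}} where
  F : Set
  F = Fin p

  0F 1F : F
  0F = 0 mod p
  1F = 1 mod p

  _+F_ _*F_ : F → F → F
  x +F y = (toℕ x ℕ.+ toℕ y) mod p
  x *F y = (toℕ x ℕ.* toℕ y) mod p

  infixl 6 _+F_
  infixl 7 _*F_

  ΣF : (m : ℕ) → (Fin m → F) → F
  ΣF zero    f = 0F
  ΣF (suc m) f = f Fin.zero +F ΣF m (λ k → f (Fin.suc k))

  -- Evaluation at T = a of β_{W,j}(T) = Σ_{l : w_{r-1-l} = j} T^l.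
  -- On the reversed word v_0 ⋯ v_{r-1} (v_l = w_{r-1-l}) this is
  -- Σ_{l : v_l = j} a^l, computed as [v_0 = j] + a·(Σ over v_1⋯).
  βrev : {m : ℕ} → List (Fin m) → Fin m → F → F
  βrev []       j a = 0F
  βrev (x ∷ xs) j a with x ≟ j
  ... | yes _ = 1F +F a *F βrev xs j a
  ... | no  _ = 0F +F a *F βrev xs j a

  βeval : {m : ℕ} → List (Fin m) → Fin m → F → F
  βeval W j a = βrev (reverse W) j a

  Mat : ℕ → Set
  Mat m = Fin m → Fin m → F

  _⊗_ : {m : ℕ} → Mat m → Mat m → Mat m
  _⊗_ {m} A B i j = ΣF m (λ k → A i k *F B k j)

  idMat : {m : ℕ} → Mat m
  idMat i j with i ≟ j
  ... | yes _ = 1F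
  ... | no  _ = 0F

  _^M_ : {m : ℕ} → Mat m → ℕ → Mat m
  A ^M zero  = idMat
  A ^M suc n = (A ^M n) ⊗ A

  Meval : {m : ℕ} → (Fin m → List (Fin m)) → F → Mat m
  Meval τ a i j = βeval (τ i) j a

Morphism : ℕ → Set
Morphism m = Fin m → List (Fin m)

applyW : {m : ℕ} → Morphism m → List (Fin m) → List (Fin m)
applyW σ w = concatMap σ w

iterM : {m : ℕ} → Morphism m → ℕ → Morphism m
iterM σ zero    i = [ i ]
iterM σ (suc n) i = applyW σ (iterM σ n i)

Uniform : {m : ℕ} → ℕ → Morphism m → Set
Uniform k σ = ∀ i → Data.List.length (σ i) ≡ k
  where open import Relation.Binary.PropositionalEquality using (_≡_)

-- Reading σ(W) from the right, it is the concatenation of the blocks σ(w),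
-- and the block of a letter w is shifted by the total length of the blocks
-- to its right, which is p times the number of letters of W to the right of w.
-- Hence β_{σ(W),j}(a) = Σ_k β_{W,k}(a^p) β_{σ(k),j}(a), and a^p = a in F_p by
-- Fermat's little theorem; for W = σ^n(i) this is the recursion
-- M_{σ^{n+1}}(a) = M_{σ^n}(a) M_σ(a).  Fermat's theorem follows from the
-- Frobenius identity (x + y)^p = x^p + y^p, valid because p divides the inner
-- binomial coefficients.

module Submission where

open import Defs
open import Data.Nat using (ℕ; NonZero; _≥_)
open import Data.Nat.Primality using (Prime)
open import Data.Fin using (Fin)
open import Relation.Binary.PropositionalEquality using (_≡_)

open import Algebra.Bundles using (CommutativeSemiring)
import Algebra.Properties.CommutativeSemiring.Binomial as Binomial
import Algebra.Properties.Monoid.Mult as Mult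
import Algebra.Properties.Semiring.Exp as Exp
import Algebra.Properties.Semiring.Mult as SemiringMult
import Algebra.Properties.Semiring.Sum as Sum
open import Data.Empty using (⊥-elim)
import Data.Fin.Base as Fin
import Data.Fin.Properties as Finₚ
import Data.List.Base as List
import Data.List.Properties as Listₚ
import Data.Nat.Base as ℕ
import Data.Nat.Properties as ℕₚ
open import Data.Sum.Base using (inj₁; inj₂)
open import Data.Vec.Functional using (Vector; head; tail; init; last; replicate)
open import Function.Base using (_∘_)
open import Relation.Nullary using (¬_; yes; no)
import Relation.Binary.PropositionalEquality as ≡
import Relation.Binary.Reasoning.Setoid as ≈-Reasoning

module _ {p : ℕ} (p-prime : Prime p) where
  open import Data.Nat.Base using (zero; suc; _<_; _*_; _∸_; _!)
  open import Data.Nat.Combinatorics using (_C_; nCk≡n!/k![n-k]!; k![n∸k]!∣n!)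
  open import Data.Nat.DivMod using (m/n*n≡m)
  open import Data.Nat.Divisibility using (_∣_; ∣⇒≤; ∣1⇒≡1; m∣m*n)
  open import Data.Nat.Primality using (euclidsLemma; ¬prime[1]; prime⇒nonZero)
  open ≡ using (sym; trans; cong; subst)

  n<p⇒p∤n! : ∀ {n} → n < p → ¬ p ∣ n !
  n<p⇒p∤n! {zero}  _     p∣1 = ¬prime[1] (subst Prime (∣1⇒≡1 p∣1) p-prime)
  n<p⇒p∤n! {suc n} 1+n<p p∣[1+n]! with euclidsLemma (suc n) (n !) p-prime p∣[1+n]!
  ... | inj₁ p∣1+n = ℕₚ.<⇒≱ 1+n<p (∣⇒≤ p∣1+n)
  ... | inj₂ p∣n!  = n<p⇒p∤n! (ℕₚ.<-trans (ℕₚ.n<1+n n) 1+n<p) p∣n!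

  p∣p! : p ∣ p !
  p∣p! = n∣n! p {{prime⇒nonZero p-prime}}
    where
    n∣n! : ∀ n → .{{NonZero n}} → n ∣ n !
    n∣n! (suc n) = m∣m*n (n !)

  pCk*k![p∸k]!≡p! : ∀ {k} → k < p → (p C k) * (k ! * (p ∸ k) !) ≡ p !
  pCk*k![p∸k]!≡p! {k} k<p = trans (cong (_* (k ! * (p ∸ k) !)) (nCk≡n!/k![n-k]! (ℕₚ.<⇒≤ k<p)))
                                  (m/n*n≡m {{ℕₚ._!*_!≢0 k (p ∸ k)}} (k![n∸k]!∣n! (ℕₚ.<⇒≤ k<p)))

  p∣pCk : ∀ {k} → 0 < k → k < p → p ∣ p C k
  p∣pCk {k} 0<k k<p
    with euclidsLemma (p C k) (k ! * (p ∸ k) !) p-prime (subst (p ∣_) (sym (pCk*k![p∸k]!≡p! k<p)) p∣p!)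
  ... | inj₁ p∣pCk = p∣pCk
  ... | inj₂ p∣k![p∸k]! with euclidsLemma (k !) ((p ∸ k) !) p-prime p∣k![p∸k]!
  ...   | inj₁ p∣k!     = ⊥-elim (n<p⇒p∤n! k<p p∣k!)
  ...   | inj₂ p∣[p∸k]! = ⊥-elim (n<p⇒p∤n! (ℕₚ.∸-monoʳ-< 0<k (ℕₚ.<⇒≤ k<p)) p∣[p∸k]!)

module _ {c ℓ} (R : CommutativeSemiring c ℓ) where
  open CommutativeSemiring R
  open Mult +-monoid using (_×_; ×-assocˡ; ×-homo-1)
  open Exp semiring using (_^_; ^-homo-*)
  open Binomial R using (binomialTerm; theorem)
  open Sum semiring using (sum; sum-init-last; sum-cong-≋; sum-replicate-zero)
  open ≈-Reasoning setoid
  open import Data.Nat.Base using (zero; suc; _∸_; s≤s; z≤n)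
  open import Data.Nat.Combinatorics using (_C_; nCn≡1)
  open import Data.Nat.Divisibility using (_∣_; divides)
  open import Data.Nat.Primality using (prime⇒nonZero)

  sum≈head+last : ∀ {n} (t : Vector Carrier (suc (suc n))) →
                  (∀ k → t (Fin.suc (Fin.inject₁ k)) ≈ 0#) → sum t ≈ head t + last t
  sum≈head+last {n} t inner≈0 = begin
    sum t                                       ≡⟨⟩
    head t + sum (tail t)                       ≈⟨ +-congˡ (sum-init-last (tail t)) ⟩
    head t + (sum (init (tail t)) + last t)     ≈⟨ +-congˡ (+-congʳ (sum-cong-≋ inner≈0)) ⟩
    head t + (sum (replicate n 0#) + last t)    ≈⟨ +-congˡ (+-congʳ (sum-replicate-zero n)) ⟩
    head t + (0# + last t)                      ≈⟨ +-congˡ (+-identityˡ (last t)) ⟩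
    head t + last t                             ∎

  p∣m⇒m×≈0 : ∀ {p m} → (∀ x → p × x ≈ 0#) → p ∣ m → ∀ x → m × x ≈ 0#
  p∣m⇒m×≈0 {p} {m} p×≈0 (divides q m≡q*p) x = begin
    m × x         ≡⟨ ≡.cong (_× x) (≡.trans m≡q*p (ℕₚ.*-comm q p)) ⟩
    (p ℕ.* q) × x ≈⟨ ×-assocˡ x p q ⟨
    p × (q × x)   ≈⟨ p×≈0 (q × x) ⟩
    0#            ∎

  frobenius : ∀ {p} → Prime p → (∀ x → p × x ≈ 0#) → ∀ x y → (x + y) ^ p ≈ x ^ p + y ^ p
  frobenius {p@(suc (suc n))} p-prime p×≈0 x y = begin
    (x + y) ^ p                                             ≈⟨ theorem p x y ⟩
    sum (binomialTerm x y p)                                ≈⟨ sum≈head+last (binomialTerm x y p) inner≈0 ⟩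
    head (binomialTerm x y p) + last (binomialTerm x y p)   ≈⟨ +-cong head≈y^p last≈x^p ⟩
    y ^ p + x ^ p                                           ≈⟨ +-comm (y ^ p) (x ^ p) ⟩
    x ^ p + y ^ p                                           ∎
    where
    head≈y^p : binomialTerm x y p Fin.zero ≈ y ^ p
    head≈y^p = trans (×-homo-1 _) (*-identityˡ (y ^ p))
    last≈x^p : binomialTerm x y p (Fin.fromℕ p) ≈ x ^ p
    last≈x^p = begin
      binomialTerm x y p (Fin.fromℕ p) ≡⟨ ≡.cong (λ k → (p C k) × (x ^ k * y ^ (p ∸ k))) (Finₚ.toℕ-fromℕ p) ⟩
      (p C p) × (x ^ p * y ^ (p ∸ p))   ≡⟨ ≡.cong₂ (λ c e → c × (x ^ p * y ^ e)) (nCn≡1 p) (ℕₚ.n∸n≡0 p) ⟩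
      1 × (x ^ p * 1#)                  ≈⟨ ×-homo-1 _ ⟩
      x ^ p * 1#                        ≈⟨ *-identityʳ (x ^ p) ⟩
      x ^ p                             ∎
    inner≈0 : ∀ k → binomialTerm x y p (Fin.suc (Fin.inject₁ k)) ≈ 0#
    inner≈0 k = p∣m⇒m×≈0 p×≈0 (p∣pCk p-prime (s≤s z≤n) (s≤s (Finₚ.inject₁ℕ< k))) _

  fermat : ∀ {p} → Prime p → (∀ x → p × x ≈ 0#) → ∀ n → (n × 1#) ^ p ≈ n × 1#
  fermat {suc q} _ _ zero = zeroˡ (0# ^ q)
  fermat {p} p-prime p×≈0 (suc n) = begin
    (1# + n × 1#) ^ p       ≈⟨ frobenius p-prime p×≈0 1# (n × 1#) ⟩
    1# ^ p + (n × 1#) ^ p   ≈⟨ +-cong 1#^p≈1# (fermat p-prime p×≈0 n) ⟩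
    1# + n × 1#             ∎
    where
    1#^p≈1# : 1# ^ p ≈ 1#
    1#^p≈1# = Mult.×-idem *-monoid (*-identityˡ 1#) p {{prime⇒nonZero p-prime}}

  x^k≈x⇒x^[n*k]≈x^n : ∀ {x k} → x ^ k ≈ x → ∀ n → x ^ (n ℕ.* k) ≈ x ^ n
  x^k≈x⇒x^[n*k]≈x^n         x^k≈x zero    = refl
  x^k≈x⇒x^[n*k]≈x^n {x} {k} x^k≈x (suc n) = begin
    x ^ (k ℕ.+ n ℕ.* k)     ≈⟨ ^-homo-* x k (n ℕ.* k) ⟩
    x ^ k * x ^ (n ℕ.* k)   ≈⟨ *-cong x^k≈x (x^k≈x⇒x^[n*k]≈x^n x^k≈x n) ⟩
    x * x ^ n               ∎

module _ (p : ℕ) .{{_ : NonZero p}} where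
  open Fp p
  open import Algebra.Core using (Op₂)
  open import Algebra.Definitions (_≡_ {A = F})
  open import Algebra.Structures (_≡_ {A = F}) using (IsCommutativeSemiring; IsCommutativeMonoid)
  open import Algebra.Structures.Biased (_≡_ {A = F}) using (isCommutativeSemiringˡ; isCommutativeMonoidˡ)
  open import Data.Nat.Base using (zero; suc; _+_; _*_; _%_)
  open import Data.Nat.DivMod using (_mod_; %-distribˡ-+; %-distribˡ-*; m%n%n≡m%n; m<n⇒m%n≡m; [m+n]%n≡m%n)
  open import Level using (0ℓ)
  open import Data.Fin.Base using (toℕ)
  open ≡ using (refl; trans; cong; cong₂)
  open ≡.≡-Reasoning

  mod-≡ : ∀ {a b} → a % p ≡ b % p → a mod p ≡ b mod p
  mod-≡ {a} {b} a≡b = Finₚ.toℕ-injective (begin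
    toℕ (a mod p) ≡⟨ Finₚ.toℕ-fromℕ< _ ⟩
    a % p         ≡⟨ a≡b ⟩
    b % p         ≡⟨ Finₚ.toℕ-fromℕ< _ ⟨
    toℕ (b mod p) ∎)

  toℕ-mod : ∀ x → toℕ x mod p ≡ x
  toℕ-mod x = Finₚ.toℕ-injective (trans (Finₚ.toℕ-fromℕ< _) (m<n⇒m%n≡m (Finₚ.toℕ<n x)))

  toℕ[n-mod-p]%p≡n%p : ∀ n → toℕ (n mod p) % p ≡ n % p
  toℕ[n-mod-p]%p≡n%p n = trans (cong (_% p) (Finₚ.toℕ-fromℕ< _)) (m%n%n≡m%n n p)

  module ReducedOp (_∙_ : Op₂ ℕ) (%-distrib : ∀ a b → (a ∙ b) % p ≡ ((a % p) ∙ (b % p)) % p) where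

    _∙F_ : Op₂ F
    x ∙F y = (toℕ x ∙ toℕ y) mod p

    ∙-cong-% : ∀ {a a′ b b′} → a % p ≡ a′ % p → b % p ≡ b′ % p → (a ∙ b) mod p ≡ (a′ ∙ b′) mod p
    ∙-cong-% {a} {a′} {b} {b′} a≡a′ b≡b′ = mod-≡ (begin
      (a ∙ b) % p                 ≡⟨ %-distrib a b ⟩
      ((a % p) ∙ (b % p)) % p     ≡⟨ cong₂ (λ u v → (u ∙ v) % p) a≡a′ b≡b′ ⟩
      ((a′ % p) ∙ (b′ % p)) % p   ≡⟨ %-distrib a′ b′ ⟨
      (a′ ∙ b′) % p               ∎)

    reduceˡ : ∀ a b → (toℕ (a mod p) ∙ b) mod p ≡ (a ∙ b) mod p
    reduceˡ a b = ∙-cong-% (toℕ[n-mod-p]%p≡n%p a) refl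

    reduceʳ : ∀ a b → (a ∙ toℕ (b mod p)) mod p ≡ (a ∙ b) mod p
    reduceʳ a b = ∙-cong-% refl (toℕ[n-mod-p]%p≡n%p b)

    ∙F-assoc : (∀ a b c → (a ∙ b) ∙ c ≡ a ∙ (b ∙ c)) → Associative _∙F_
    ∙F-assoc assoc x y z = begin
      (toℕ (x ∙F y) ∙ toℕ z) mod p       ≡⟨ reduceˡ (toℕ x ∙ toℕ y) (toℕ z) ⟩
      ((toℕ x ∙ toℕ y) ∙ toℕ z) mod p    ≡⟨ cong (_mod p) (assoc (toℕ x) (toℕ y) (toℕ z)) ⟩
      (toℕ x ∙ (toℕ y ∙ toℕ z)) mod p    ≡⟨ reduceʳ (toℕ x) (toℕ y ∙ toℕ z) ⟨
      (toℕ x ∙ toℕ (y ∙F z)) mod p       ∎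

    ∙F-comm : (∀ a b → a ∙ b ≡ b ∙ a) → Commutative _∙F_
    ∙F-comm comm x y = cong (_mod p) (comm (toℕ x) (toℕ y))

    ∙F-identityˡ : ∀ {e} → (∀ a → e ∙ a ≡ a) → LeftIdentity (e mod p) _∙F_
    ∙F-identityˡ {e} identityˡ x = begin
      (toℕ (e mod p) ∙ toℕ x) mod p   ≡⟨ reduceˡ e (toℕ x) ⟩
      (e ∙ toℕ x) mod p               ≡⟨ cong (_mod p) (identityˡ (toℕ x)) ⟩
      toℕ x mod p                     ≡⟨ toℕ-mod x ⟩
      x                               ∎

  -- `_+F_` and `_*F_` are definitionally `+._∙F_` and `*._∙F_`.
  module + = ReducedOp _+_ (λ a b → %-distribˡ-+ a b p)
  module * = ReducedOp _*_ (λ a b → %-distribˡ-* a b p)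

  *F-distribʳ-+F : _*F_ DistributesOverʳ _+F_
  *F-distribʳ-+F x y z = begin
    (toℕ (y +F z) * toℕ x) mod p             ≡⟨ *.reduceˡ (toℕ y + toℕ z) (toℕ x) ⟩
    ((toℕ y + toℕ z) * toℕ x) mod p          ≡⟨ cong (_mod p) (ℕₚ.*-distribʳ-+ (toℕ x) (toℕ y) (toℕ z)) ⟩
    (toℕ y * toℕ x + toℕ z * toℕ x) mod p    ≡⟨ +.∙-cong-% (toℕ[n-mod-p]%p≡n%p _) (toℕ[n-mod-p]%p≡n%p _) ⟨
    (toℕ (y *F x) + toℕ (z *F x)) mod p      ∎

  +F-*F-isCommutativeSemiring : IsCommutativeSemiring _+F_ _*F_ 0F 1F
  +F-*F-isCommutativeSemiring = isCommutativeSemiringˡ record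
    { +-isCommutativeMonoid =
        commutativeMonoid (+.∙F-assoc ℕₚ.+-assoc) (+.∙F-identityˡ ℕₚ.+-identityˡ) (+.∙F-comm ℕₚ.+-comm)
    ; *-isCommutativeMonoid =
        commutativeMonoid (*.∙F-assoc ℕₚ.*-assoc) (*.∙F-identityˡ ℕₚ.*-identityˡ) (*.∙F-comm ℕₚ.*-comm)
    ; distribʳ              = *F-distribʳ-+F
    ; zeroˡ                 = λ x → *.reduceˡ 0 (toℕ x)
    }
    where
    commutativeMonoid : ∀ {_∙_ : Op₂ F} {e : F} →
                        Associative _∙_ → LeftIdentity e _∙_ → Commutative _∙_ → IsCommutativeMonoid _∙_ e
    commutativeMonoid {_∙_} assoc identityˡ comm = isCommutativeMonoidˡ record
      { isSemigroup = record { isMagma = record { isEquivalence = ≡.isEquivalence ; ∙-cong = cong₂ _∙_ } ; assoc = assoc }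
      ; identityˡ   = identityˡ
      ; comm        = comm
      }

  𝔽 : CommutativeSemiring 0ℓ 0ℓ
  𝔽 = record { isCommutativeSemiring = +F-*F-isCommutativeSemiring }

  open Mult (CommutativeSemiring.+-monoid 𝔽) using (_×_)
  open Exp (CommutativeSemiring.semiring 𝔽) using (_^_)

  n×1F≡n-mod-p : ∀ n → n × 1F ≡ n mod p
  n×1F≡n-mod-p zero    = refl
  n×1F≡n-mod-p (suc n) = trans (cong (1F +F_) (n×1F≡n-mod-p n))
                               (+.∙-cong-% {a′ = 1} {b′ = n} (toℕ[n-mod-p]%p≡n%p 1) (toℕ[n-mod-p]%p≡n%p n))

  p×x≡0F : ∀ x → p × x ≡ 0F
  p×x≡0F x = begin
    p × x            ≡⟨ cong (p ×_) (*-identityˡ x) ⟨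
    p × (1F *F x)    ≡⟨ ×-assoc-* p 1F x ⟨
    (p × 1F) *F x    ≡⟨ cong (_*F x) (trans (n×1F≡n-mod-p p) (mod-≡ ([m+n]%n≡m%n 0 p))) ⟩
    0F *F x          ≡⟨ zeroˡ x ⟩
    0F               ∎
    where
    open CommutativeSemiring 𝔽 using (*-identityˡ; zeroˡ)
    open SemiringMult (CommutativeSemiring.semiring 𝔽) using (×-assoc-*)

  fermatF : Prime p → ∀ a → a ^ p ≡ a
  fermatF p-prime a = begin
    a ^ p                ≡⟨ cong (_^ p) toℕa×1F≡a ⟨
    (toℕ a × 1F) ^ p     ≡⟨ fermat 𝔽 p-prime p×x≡0F (toℕ a) ⟩
    toℕ a × 1F           ≡⟨ toℕa×1F≡a ⟩
    a                    ∎
    where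
    toℕa×1F≡a : toℕ a × 1F ≡ a
    toℕa×1F≡a = trans (n×1F≡n-mod-p (toℕ a)) (toℕ-mod a)

module _ {p : ℕ} .{{_ : NonZero p}} where
  open Fp p
  open CommutativeSemiring (𝔽 p)
    using (+-identityˡ; +-identityʳ; +-assoc; *-identityˡ; *-assoc; zeroˡ; zeroʳ; distribˡ; distribʳ)
  open Exp (CommutativeSemiring.semiring (𝔽 p)) using (_^_)
  open Sum (CommutativeSemiring.semiring (𝔽 p))
    using (sum; sum-remove; sum-cong-≗; sum-replicate-zero; ∑-distrib-+; *-distribˡ-sum)
  open import Data.Nat.Base using (zero; suc; _+_; _*_)
  open import Data.Fin using (_≟_)
  open List using (List; []; _∷_; [_]; _++_; length; reverse)
  open ≡ using (_≢_; refl; sym; trans; cong; cong₂)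
  open ≡.≡-Reasoning

  idMat-diag : ∀ {m} (i : Fin m) → idMat i i ≡ 1F
  idMat-diag i with i ≟ i
  ... | yes _   = refl
  ... | no i≢i  = ⊥-elim (i≢i refl)

  idMat-offdiag : ∀ {m} {i j : Fin m} → i ≢ j → idMat i j ≡ 0F
  idMat-offdiag {i = i} {j} i≢j with i ≟ j
  ... | yes i≡j = ⊥-elim (i≢j i≡j)
  ... | no _    = refl

  ΣF≡sum : ∀ {m} (f : Fin m → F) → ΣF m f ≡ sum f
  ΣF≡sum {zero}  f = refl
  ΣF≡sum {suc m} f = cong (f Fin.zero +F_) (ΣF≡sum (f ∘ Fin.suc))

  ⊗-identityˡ : ∀ {m} (A : Mat m) i j → (idMat ⊗ A) i j ≡ A i j
  ⊗-identityˡ {suc m} A i j = begin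
    ΣF (suc m) t                                    ≡⟨ ΣF≡sum t ⟩
    sum t                                           ≡⟨ sum-remove {i = i} t ⟩
    t i +F sum (t ∘ Fin.punchIn i)                  ≡⟨ cong₂ _+F_ (cong (_*F A i j) (idMat-diag i)) (sum-cong-≗ off-diagonal≡0F) ⟩
    1F *F A i j +F sum {m} (λ _ → 0F)               ≡⟨ cong₂ _+F_ (*-identityˡ (A i j)) (sum-replicate-zero m) ⟩
    A i j +F 0F                                     ≡⟨ +-identityʳ (A i j) ⟩
    A i j                                           ∎
    where
    t : Fin (suc m) → F
    t k = idMat i k *F A k j
    off-diagonal≡0F : ∀ k → t (Fin.punchIn i k) ≡ 0F
    off-diagonal≡0F k = trans (cong (_*F A (Fin.punchIn i k) j) (idMat-offdiag (Finₚ.punchInᵢ≢i i k ∘ sym))) (zeroˡ _)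

  βrev-∷ : ∀ {m} (x : Fin m) xs j a → βrev (x ∷ xs) j a ≡ idMat x j +F a *F βrev xs j a
  βrev-∷ x xs j a with x ≟ j
  ... | yes _ = refl
  ... | no _  = refl

  βrev-++ : ∀ {m} (u v : List (Fin m)) j a → βrev (u ++ v) j a ≡ βrev u j a +F a ^ length u *F βrev v j a
  βrev-++ []      v j a = sym (trans (+-identityˡ _) (*-identityˡ (βrev v j a)))
  βrev-++ (x ∷ u) v j a = begin
    βrev (x ∷ u ++ v) j a                                 ≡⟨ βrev-∷ x (u ++ v) j a ⟩
    δ +F a *F βrev (u ++ v) j a                           ≡⟨ cong (λ r → δ +F a *F r) (βrev-++ u v j a) ⟩
    δ +F a *F (βrev u j a +F a ^ length u *F V)           ≡⟨ cong (δ +F_) (distribˡ a (βrev u j a) _) ⟩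
    δ +F (a *F βrev u j a +F a *F (a ^ length u *F V))    ≡⟨ +-assoc δ _ _ ⟨
    (δ +F a *F βrev u j a) +F a *F (a ^ length u *F V)    ≡⟨ cong₂ _+F_ (βrev-∷ x u j a) (*-assoc a (a ^ length u) V) ⟨
    βrev (x ∷ u) j a +F a ^ length (x ∷ u) *F V           ∎
    where
    δ V : F
    δ = idMat x j
    V = βrev v j a

  βeval-++ : ∀ {m} (u v : List (Fin m)) j a → βeval (u ++ v) j a ≡ βeval v j a +F a ^ length v *F βeval u j a
  βeval-++ u v j a = begin
    βrev (reverse (u ++ v)) j a                               ≡⟨ cong (λ w → βrev w j a) (Listₚ.reverse-++ u v) ⟩
    βrev (reverse v ++ reverse u) j a                         ≡⟨ βrev-++ (reverse v) (reverse u) j a ⟩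
    βeval v j a +F a ^ length (reverse v) *F βeval u j a
      ≡⟨ cong (λ n → βeval v j a +F a ^ n *F βeval u j a) (Listₚ.length-reverse v) ⟩
    βeval v j a +F a ^ length v *F βeval u j a                ∎

  βeval-[_] : ∀ {m} (x : Fin m) j a → βeval [ x ] j a ≡ idMat x j
  βeval-[ x ] j a = begin
    βrev [ x ] j a          ≡⟨ βrev-∷ x [] j a ⟩
    idMat x j +F a *F 0F    ≡⟨ cong (idMat x j +F_) (zeroʳ a) ⟩
    idMat x j +F 0F         ≡⟨ +-identityʳ (idMat x j) ⟩
    idMat x j               ∎

  βeval-∷ : ∀ {m} (x : Fin m) W j a → βeval (x ∷ W) j a ≡ βeval W j a +F a ^ length W *F idMat x j
  βeval-∷ x W j a =
    trans (βeval-++ [ x ] W j a) (cong (λ δ → βeval W j a +F a ^ length W *F δ) (βeval-[ x ] j a))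

  module _ {m k : ℕ} {σ : Morphism m} (uniform : Uniform k σ) where

    length-applyW : ∀ W → length (applyW σ W) ≡ length W * k
    length-applyW []      = refl
    length-applyW (x ∷ W) = trans (Listₚ.length-++ (σ x)) (cong₂ _+_ (uniform x) (length-applyW W))

    βeval-applyW : ∀ {a} → a ^ k ≡ a →
                   ∀ W j → βeval (applyW σ W) j a ≡ sum (λ l → βeval W l a *F Meval σ a l j)
    βeval-applyW {a} a^k≡a []      j = sym (trans (sym (*-distribˡ-sum 0F (λ l → Meval σ a l j))) (zeroˡ _))
    βeval-applyW {a} a^k≡a (x ∷ W) j = begin
      βeval (σ x ++ applyW σ W) j a
        ≡⟨ βeval-++ (σ x) (applyW σ W) j a ⟩
      βeval (applyW σ W) j a +F a ^ length (applyW σ W) *F M x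
        ≡⟨ cong₂ (λ s c → s +F c *F M x) (βeval-applyW a^k≡a W j) a^|σW|≡a^|W| ⟩
      S +F c *F M x                                 ≡⟨ cong (λ t → S +F c *F t) Mx≡∑δM ⟩
      S +F c *F sum δM                              ≡⟨ cong (S +F_) (*-distribˡ-sum c δM) ⟩
      S +F sum (λ l → c *F δM l)                    ≡⟨ ∑-distrib-+ (λ l → βeval W l a *F M l) (λ l → c *F δM l) ⟨
      sum (λ l → βeval W l a *F M l +F c *F δM l)   ≡⟨ sum-cong-≗ regroup ⟨
      sum (λ l → βeval (x ∷ W) l a *F M l)          ∎
      where
      M : Fin m → F
      M l = Meval σ a l j
      c S : F
      c = a ^ length W
      S = sum (λ l → βeval W l a *F M l)
      δM : Fin m → F
      δM l = idMat x l *F M l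
      a^|σW|≡a^|W| : a ^ length (applyW σ W) ≡ c
      a^|σW|≡a^|W| = trans (cong (a ^_) (length-applyW W)) (x^k≈x⇒x^[n*k]≈x^n (𝔽 p) a^k≡a (length W))
      Mx≡∑δM : M x ≡ sum δM
      Mx≡∑δM = trans (sym (⊗-identityˡ (Meval σ a) x j)) (ΣF≡sum δM)
      regroup : ∀ l → βeval (x ∷ W) l a *F M l ≡ βeval W l a *F M l +F c *F δM l
      regroup l = begin
        βeval (x ∷ W) l a *F M l                        ≡⟨ cong (_*F M l) (βeval-∷ x W l a) ⟩
        (βeval W l a +F c *F idMat x l) *F M l          ≡⟨ distribʳ (M l) (βeval W l a) (c *F idMat x l) ⟩
        βeval W l a *F M l +F (c *F idMat x l) *F M l   ≡⟨ cong (βeval W l a *F M l +F_) (*-assoc c (idMat x l) (M l)) ⟩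
        βeval W l a *F M l +F c *F δM l                 ∎

    Meval-iterM : ∀ {a} → a ^ k ≡ a → ∀ n i j → Meval (iterM σ n) a i j ≡ (Meval σ a ^M n) i j
    Meval-iterM {a} a^k≡a zero    i j = βeval-[ i ] j a
    Meval-iterM {a} a^k≡a (suc n) i j = begin
      βeval (applyW σ (iterM σ n i)) j a                    ≡⟨ βeval-applyW a^k≡a (iterM σ n i) j ⟩
      sum (λ l → Meval (iterM σ n) a i l *F Meval σ a l j)  ≡⟨ sum-cong-≗ (λ l → cong (_*F M l) (Meval-iterM a^k≡a n i l)) ⟩
      sum (λ l → (Meval σ a ^M n) i l *F Meval σ a l j)     ≡⟨ ΣF≡sum (λ l → (Meval σ a ^M n) i l *F M l) ⟨
      (Meval σ a ^M suc n) i j                              ∎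
      where
      M : Fin m → F
      M l = Meval σ a l j

corollary4p13 : (p : ℕ) .{{_ : NonZero p}} → Prime p → (m : ℕ) → m ≥ 1 →
    (σ : Morphism m) → Uniform p σ → (a : Fp.F p) → (n : ℕ) →
    ∀ (i j : Fin m) → Fp.Meval p (iterM σ n) a i j ≡ Fp._^M_ p (Fp.Meval p σ a) n i j
corollary4p13 p p-prime m _ σ uniform a = Meval-iterM uniform (fermatF p p-prime a)
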